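{- Let $k \ge 2$ and let $F$ be a $k$-instance with average clause length $\eta$. Let $\theta$ be the average clause length of the maximal satisfiable subformula of $F$ (the clauses satisfied by an assignment maximizing the number of satisfied clauses). If $\eta, \theta > 1$, then $\frac{2}{\theta - 1} \ge \frac{1}{\eta - 1} + \frac{1}{k-1}\cdot\frac{2^{k-1}-1}{2^{k-1}}$. Moreover, suppose $F$ has no $1$-clause and let $\theta'$ be the average clause length of the maximal NAE-satisfiable subformula of $F$ (the clauses NAE-satisfied by an assignment maximizing the number of NAE-satisfied clauses). Then $\theta' = 2$ when $k = 2$, and when $k \ge 3$ (and $\eta, \theta' > 2$), $\frac{2}{\theta' - 2} \ge \frac{1}{\eta - 2} + \frac{1}{k-2}\cdot\frac{2^{k-2}-1}{2^{k-2}}$.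
   Context: A clause is a nonempty set of literals; an $i$-clause has exactly $i$ literals; a $k$-instance is a finite set of clauses each with at most $k$ literals. A clause is satisfied if at least one literal is true, NAE-satisfied if at least one literal is true and at least one is false. The average clause length of a formula with $m_i$ $i$-clauses is $(\sum_i i\, m_i)/\sum_i m_i$. -}

module Defs where

open import Data.Nat as ℕ using (ℕ; zero; suc; _∸_; _^_)
open import Data.Integer using (+_)
open import Data.Rational as ℚ using (ℚ; 0ℚ; _/_; 1/_; ≢-nonZero)
open import Data.Rational.Properties using (_≟_)
open import Data.Bool using (Bool; true; false)
open import Data.Fin using (Fin)
open import Data.Product using (_×_; _,_; proj₁; proj₂)
open import Data.List using (List; []; _∷_; length; filter; map)
open import Data.Nat.ListAction using (sum)
open import Data.List.Relation.Unary.Any using (Any)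
open import Data.List.Relation.Unary.Any using (any?) public
open import Data.List.Relation.Unary.All using (All)
open import Data.List.Relation.Unary.Unique.Propositional using (Unique)
open import Data.List.Relation.Unary.AllPairs using (AllPairs)
open import Data.List.Membership.Propositional using (_∈_)
open import Data.List.Relation.Binary.Subset.Propositional using (_⊆_)
open import Relation.Nullary using (¬_; yes; no)
open import Relation.Nullary.Decidable using (_×-dec_)
open import Relation.Binary.PropositionalEquality using (_≡_)
open import Data.Bool.Properties renaming (_≟_ to _≟ᵇ_)

-- Variables are Fin n; a literal is (variable, polarity):
-- (x , true) is the positive literal x, (x , false) is ¬x.
Literal : ℕ → Set
Literal n = Fin n × Bool

-- A clause is a nonempty set of literals, represented as a
-- duplicate-free nonempty list.
record Clause (n : ℕ) : Set where
  constructor clause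
  field
    lits     : List (Literal n)
    nonempty : ¬ (lits ≡ [])
    distinct : Unique lits
open Clause public

len : ∀ {n} → Clause n → ℕ
len C = length (lits C)

SameSet : ∀ {n} → Clause n → Clause n → Set
SameSet C D = (lits C ⊆ lits D) × (lits D ⊆ lits C)

-- A formula is a finite set of clauses: a list of pairwise distinct
-- (as sets) clauses.
record Formula (n : ℕ) : Set where
  constructor formula
  field
    clauses  : List (Clause n)
    distinct : AllPairs (λ C D → ¬ SameSet C D) clauses
open Formula public

IsKInstance : ∀ {n} → ℕ → Formula n → Set
IsKInstance k F = All (λ C → len C ℕ.≤ k) (clauses F)

NoUnitClause : ∀ {n} → Formula n → Set
NoUnitClause F = All (λ C → ¬ (len C ≡ 1)) (clauses F)

Assignment : ℕ → Set
Assignment n = Fin n → Bool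

litTrue? : ∀ {n} (α : Assignment n) (l : Literal n) → _
litTrue? α (x , b) = α x ≟ᵇ b

litFalse? : ∀ {n} (α : Assignment n) (l : Literal n) → _
litFalse? α (x , b) = Relation.Nullary.Decidable.¬? (α x ≟ᵇ b)
  where import Relation.Nullary.Decidable

satisfied? : ∀ {n} (α : Assignment n) (C : Clause n) → _
satisfied? α C = any? (litTrue? α) (lits C)

naeSatisfied? : ∀ {n} (α : Assignment n) (C : Clause n) → _
naeSatisfied? α C = any? (litTrue? α) (lits C) ×-dec any? (litFalse? α) (lits C)

satClauses : ∀ {n} → Assignment n → List (Clause n) → List (Clause n)
satClauses α = filter (satisfied? α)

naeClauses : ∀ {n} → Assignment n → List (Clause n) → List (Clause n)
naeClauses α = filter (naeSatisfied? α)

MaxSat : ∀ {n} → Formula n → Assignment n → Set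
MaxSat {n} F α = ∀ (β : Assignment n) →
  length (satClauses β (clauses F)) ℕ.≤ length (satClauses α (clauses F))

MaxNAE : ∀ {n} → Formula n → Assignment n → Set
MaxNAE {n} F α = ∀ (β : Assignment n) →
  length (naeClauses β (clauses F)) ℕ.≤ length (naeClauses α (clauses F))

ℕ→ℚ : ℕ → ℚ
ℕ→ℚ m = + m / 1

-- average clause length (sum of lengths / number of clauses) of a list of
-- clauses; the empty list (where it is undefined) gets the value 0.
avgLen : ∀ {n} → List (Clause n) → ℚ
avgLen Cs with length Cs
... | zero  = 0ℚ
... | suc m = + sum (map len Cs) / suc m

-- reciprocal; only ever applied to nonzero arguments in the statement
-- (junk value 0 at 0)
inv : ℚ → ℚ
inv p with p ≟ 0ℚ
... | yes _ = 0ℚ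
... | no p≢0 = 1/_ p {{≢-nonZero p≢0}}

module Submission where

-- Let r = 1 for satisfaction and r = 2 for NAE-satisfaction, K = k - r, and call j_C = |C| - r the
-- excess of a clause. A uniformly random assignment fails C with probability 2^-(1 + j_C) (all
-- literals false, resp. all equal), so an optimal assignment leaves U <= Σ_C 2^-(1 + j_C) clauses
-- failed. Convexity of j ↦ 2^-j on [0, K] bounds 2^-j by its chord 1 - c j, c = (2^K - 1)/(K 2^K);
-- with M clauses, X of them kept and total excess J = (η - r) M this gives M + c J <= 2 X. The kept
-- clauses have excess (θ - r) X <= J, hence (1/(η - r) + c) J = M + c J <= 2 X <= 2 J/(θ - r).
-- For k = 2 every clause is a NAE-satisfiable 2-clause, so the optimum is nonempty of average 2.

open import Defs

module _ where
  open import Data.Nat using (ℕ; zero; suc; _+_; _*_; _∸_; _^_; _≤_; _<_; z≤n; s≤s)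
  open import Data.Nat.Properties
  open import Data.Nat.ListAction using (sum)
  open import Data.Nat.Tactic.RingSolver using (solve-∀)
  open import Algebra.Properties.CommutativeSemigroup +-commutativeSemigroup
    using (interchange; x∙yz≈y∙xz)
  open import Algebra.Properties.CommutativeSemigroup *-commutativeSemigroup
    using () renaming (x∙yz≈y∙xz to x*[y*z]≡y*[x*z])
  open import Data.Bool using (Bool; true; false; not; if_then_else_)
  open import Data.Bool.Properties using (not-injective; not-involutive; not-¬; ¬-not) renaming (_≟_ to _≟ᵇ_)
  open import Data.Fin using (Fin; zero; suc) renaming (_≟_ to _≟ᶠ_)
  open import Data.Product using (_,_; proj₁; proj₂; ∃)
  open import Data.List using (List; []; _∷_; length; map; filter)
  open import Data.List.Properties using (length-map)
  open import Data.List.Membership.Propositional using (_∉_)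
  open import Data.List.Relation.Unary.Any using (here; there)
  open import Data.List.Relation.Unary.All as All using (All; []; _∷_)
  open import Data.List.Relation.Unary.All.Properties using (All¬⇒¬Any)
  open import Data.List.Relation.Unary.AllPairs using (_∷_)
  open import Data.List.Relation.Unary.Unique.Propositional using (Unique)
  import Data.List.Relation.Unary.Unique.Propositional.Properties as Unique
  open import Relation.Nullary using (Dec; yes; no; does)
  open import Relation.Nullary.Decidable using (_×-dec_; dec-true)
  open import Data.Empty using (⊥-elim)
  open import Relation.Unary using (Pred; Decidable)
  open import Relation.Unary.Properties using (∁?)
  open import Relation.Binary.PropositionalEquality hiding (J)
  open import Function using (_∘_)

  -- Counting assignments

  extend : ∀ {n} → Bool → Assignment n → Assignment (suc n)
  extend b β zero    = b
  extend b β (suc i) = β i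

  ∑ₐ : ∀ n → (Assignment n → ℕ) → ℕ
  ∑ₐ zero    f = f (λ ())
  ∑ₐ (suc n) f = ∑ₐ n (f ∘ extend true) + ∑ₐ n (f ∘ extend false)

  ∑ₐ-cong : ∀ n {f g : Assignment n → ℕ} → (∀ β → f β ≡ g β) → ∑ₐ n f ≡ ∑ₐ n g
  ∑ₐ-cong zero    f≡g = f≡g _
  ∑ₐ-cong (suc n) f≡g = cong₂ _+_ (∑ₐ-cong n (f≡g ∘ _)) (∑ₐ-cong n (f≡g ∘ _))

  ∑ₐ-mono-≤ : ∀ n {f g : Assignment n → ℕ} → (∀ β → f β ≤ g β) → ∑ₐ n f ≤ ∑ₐ n g
  ∑ₐ-mono-≤ zero    f≤g = f≤g _
  ∑ₐ-mono-≤ (suc n) f≤g = +-mono-≤ (∑ₐ-mono-≤ n (f≤g ∘ _)) (∑ₐ-mono-≤ n (f≤g ∘ _))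

  ∑ₐ-+ : ∀ n (f g : Assignment n → ℕ) → ∑ₐ n (λ β → f β + g β) ≡ ∑ₐ n f + ∑ₐ n g
  ∑ₐ-+ zero    f g = refl
  ∑ₐ-+ (suc n) f g = trans (cong₂ _+_ (∑ₐ-+ n (f ∘ extend true) (g ∘ extend true))
                                      (∑ₐ-+ n (f ∘ extend false) (g ∘ extend false)))
                           (interchange (∑ₐ n (f ∘ extend true)) (∑ₐ n (g ∘ extend true)) _ _)

  ∑ₐ-const : ∀ n c → ∑ₐ n (λ _ → c) ≡ 2 ^ n * c
  ∑ₐ-const zero    c = sym (*-identityˡ c)
  ∑ₐ-const (suc n) c = begin
    ∑ₐ n (λ _ → c) + ∑ₐ n (λ _ → c) ≡⟨ cong₂ _+_ (∑ₐ-const n c) (∑ₐ-const n c) ⟩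
    2 ^ n * c + 2 ^ n * c           ≡⟨ cong (2 ^ n * c +_) (sym (+-identityʳ _)) ⟩
    2 * (2 ^ n * c)                 ≡⟨ *-assoc 2 (2 ^ n) c ⟨
    2 ^ suc n * c                   ∎
    where open ≡-Reasoning

  flip : ∀ {n} → Fin n → Assignment n → Assignment n
  flip zero    β = extend (not (β zero)) (β ∘ suc)
  flip (suc x) β = extend (β zero) (flip x (β ∘ suc))

  flip-at : ∀ {n} x (β : Assignment n) → flip x β x ≡ not (β x)
  flip-at zero    β = refl
  flip-at (suc x) β = flip-at x (β ∘ suc)

  flip-elsewhere : ∀ {n} {x y : Fin n} (β : Assignment n) → y ≢ x → flip x β y ≡ β y
  flip-elsewhere {x = zero}  {zero}  β y≢x = ⊥-elim (y≢x refl)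
  flip-elsewhere {x = zero}  {suc y} β y≢x = refl
  flip-elsewhere {x = suc x} {zero}  β y≢x = refl
  flip-elsewhere {x = suc x} {suc y} β y≢x = flip-elsewhere (β ∘ suc) (λ y≡x → y≢x (cong suc y≡x))

  ∑ₐ-flip : ∀ n x (f : Assignment n → ℕ) → ∑ₐ n (f ∘ flip x) ≡ ∑ₐ n f
  ∑ₐ-flip (suc n) zero    f = +-comm (∑ₐ n (f ∘ extend false)) _
  ∑ₐ-flip (suc n) (suc x) f = cong₂ _+_ (∑ₐ-flip n x (f ∘ extend true)) (∑ₐ-flip n x (f ∘ extend false))

  allFalse : ∀ {n} → List (Literal n) → Assignment n → ℕ
  allFalse []       β = 1
  allFalse (l ∷ ls) β = if does (litTrue? β l) then 0 else allFalse ls β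

  allFalseWhenTrue : ∀ {n} → Literal n → List (Literal n) → Assignment n → ℕ
  allFalseWhenTrue l ls β = if does (litTrue? β l) then allFalse ls β else 0

  allFalse-split : ∀ {n} l (ls : List (Literal n)) β →
    allFalse ls β ≡ allFalseWhenTrue l ls β + allFalse (l ∷ ls) β
  allFalse-split l ls β with does (litTrue? β l)
  ... | true  = sym (+-identityʳ _)
  ... | false = refl

  allFalse-flip-≤ : ∀ {n} {x : Fin n} {b} ls (β : Assignment n) → β x ≡ not b → (x , b) ∉ ls →
    allFalse ls β ≤ allFalse ls (flip x β)
  allFalse-flip-≤ []             β βx x∉ = ≤-refl
  allFalse-flip-≤ {x = x} ((y , c) ∷ ls) β βx x∉ with y ≟ᶠ x
  ... | yes refl with β y ≟ᵇ c
  ...   | yes _    = z≤n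
  ...   | no βy≢c  = ⊥-elim (x∉ (here (cong (y ,_) (not-injective (trans (sym βx) (¬-not βy≢c))))))
  allFalse-flip-≤ {x = x} ((y , c) ∷ ls) β βx x∉ | no y≢x rewrite flip-elsewhere β y≢x with β y ≟ᵇ c
  ... | yes _ = ≤-refl
  ... | no _  = allFalse-flip-≤ ls β βx (x∉ ∘ there)

  allFalse-∷-≤-flip : ∀ {n} (x : Fin n) b ls β → (x , b) ∉ ls →
    allFalse ((x , b) ∷ ls) β ≤ allFalseWhenTrue (x , b) ls (flip x β)
  allFalse-∷-≤-flip x b ls β x∉ with β x ≟ᵇ b
  ... | yes _    = z≤n
  ... | no βx≢b
    rewrite dec-true (flip x β x ≟ᵇ b) (trans (flip-at x β) (trans (cong not (¬-not βx≢b)) (not-involutive b)))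
    = allFalse-flip-≤ ls β (¬-not βx≢b) x∉

  -- Flipping x maps the assignments falsifying (x , b) ∷ ls injectively to assignments that
  -- falsify ls but satisfy (x , b).
  ∑ₐ-allFalse-∷ : ∀ n (x : Fin n) b ls → (x , b) ∉ ls →
    2 * ∑ₐ n (allFalse ((x , b) ∷ ls)) ≤ ∑ₐ n (allFalse ls)
  ∑ₐ-allFalse-∷ n x b ls x∉ = begin
    2 * ∑ₐ n A                     ≡⟨ cong (∑ₐ n A +_) (+-identityʳ _) ⟩
    ∑ₐ n A + ∑ₐ n A                ≤⟨ +-monoˡ-≤ (∑ₐ n A) A≤W ⟩
    ∑ₐ n W + ∑ₐ n A                ≡⟨ ∑ₐ-+ n W A ⟨
    ∑ₐ n (λ β → W β + A β)         ≡⟨ ∑ₐ-cong n (allFalse-split (x , b) ls) ⟨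
    ∑ₐ n (allFalse ls)             ∎
    where
    open ≤-Reasoning
    A W : Assignment n → ℕ
    A = allFalse ((x , b) ∷ ls)
    W = allFalseWhenTrue (x , b) ls
    A≤W : ∑ₐ n A ≤ ∑ₐ n W
    A≤W = ≤-trans (∑ₐ-mono-≤ n (λ β → allFalse-∷-≤-flip x b ls β x∉)) (≤-reflexive (∑ₐ-flip n x W))

  ∑ₐ-allFalse : ∀ n (ls : List (Literal n)) → Unique ls → 2 ^ length ls * ∑ₐ n (allFalse ls) ≤ 2 ^ n
  ∑ₐ-allFalse n []             _          = ≤-reflexive (trans (+-identityʳ _) (trans (∑ₐ-const n 1) (*-identityʳ _)))
  ∑ₐ-allFalse n ((x , b) ∷ ls) (l≢ls ∷ ls!) = begin
    2 * 2 ^ length ls * A   ≡⟨ cong (_* A) (*-comm 2 (2 ^ length ls)) ⟩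
    2 ^ length ls * 2 * A   ≡⟨ *-assoc (2 ^ length ls) 2 A ⟩
    2 ^ length ls * (2 * A) ≤⟨ *-monoʳ-≤ (2 ^ length ls) (∑ₐ-allFalse-∷ n x b ls (All¬⇒¬Any l≢ls)) ⟩
    2 ^ length ls * ∑ₐ n (allFalse ls) ≤⟨ ∑ₐ-allFalse n ls ls! ⟩
    2 ^ n                   ∎
    where
    open ≤-Reasoning
    A : ℕ
    A = ∑ₐ n (allFalse ((x , b) ∷ ls))

  negate : ∀ {n} → Literal n → Literal n
  negate (x , b) = x , not b

  allTrue : ∀ {n} → List (Literal n) → Assignment n → ℕ
  allTrue ls = allFalse (map negate ls)

  ∑ₐ-allTrue : ∀ n (ls : List (Literal n)) → Unique ls → 2 ^ length ls * ∑ₐ n (allTrue ls) ≤ 2 ^ n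
  ∑ₐ-allTrue n ls ls! = subst (λ m → 2 ^ m * ∑ₐ n (allTrue ls) ≤ 2 ^ n) (length-map negate ls)
    (∑ₐ-allFalse n (map negate ls) (Unique.map⁺ negate-injective ls!))
    where
    negate-injective : ∀ {l m : Literal n} → negate l ≡ negate m → l ≡ m
    negate-injective e = cong₂ _,_ (cong proj₁ e) (not-injective (cong proj₂ e))

  indicator : ∀ {p} {P : Set p} → Dec P → ℕ
  indicator P? = if does P? then 1 else 0

  satisfied-or-allFalse : ∀ {n} (β : Assignment n) ls → 1 ≤ indicator (any? (litTrue? β) ls) + allFalse ls β
  satisfied-or-allFalse β []       = ≤-refl
  satisfied-or-allFalse β (l ∷ ls) with litTrue? β l
  ... | yes _ = ≤-refl
  ... | no _  = satisfied-or-allFalse β ls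

  falsified-or-allTrue : ∀ {n} (β : Assignment n) ls → 1 ≤ indicator (any? (litFalse? β) ls) + allTrue ls β
  falsified-or-allTrue β []             = ≤-refl
  falsified-or-allTrue β ((x , b) ∷ ls) with β x ≟ᵇ b | β x ≟ᵇ not b
  ... | yes βx≡b | yes βx≡¬b = ⊥-elim (not-¬ βx≡b βx≡¬b)
  ... | yes _    | no _      = falsified-or-allTrue β ls
  ... | no _     | _         = s≤s z≤n

  indicator-×-dec : ∀ {p q} {P : Set p} {Q : Set q} (P? : Dec P) (Q? : Dec Q) {f t} →
    1 ≤ indicator P? + f → 1 ≤ indicator Q? + t → 1 ≤ indicator (P? ×-dec Q?) + (f + t)
  indicator-×-dec (yes _) (yes _)         _  _  = s≤s z≤n
  indicator-×-dec (yes _) (no _)  {f}     _     1≤Q+t = ≤-trans 1≤Q+t (m≤n+m _ f)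
  indicator-×-dec (no _)  _       {f} {t} 1≤P+f _     = ≤-trans 1≤P+f (m≤m+n f t)

  naeSatisfied-or-constant : ∀ {n} (β : Assignment n) C →
    1 ≤ indicator (naeSatisfied? β C) + (allFalse (lits C) β + allTrue (lits C) β)
  naeSatisfied-or-constant β C = indicator-×-dec (any? (litTrue? β) (lits C)) (any? (litFalse? β) (lits C))
    (satisfied-or-allFalse β (lits C)) (falsified-or-allTrue β (lits C))

  module _ {a} {A : Set a} where

    ∑ₗ : (A → ℕ) → List A → ℕ
    ∑ₗ f xs = sum (map f xs)

    ∑ₗ-+ : ∀ (f g : A → ℕ) xs → ∑ₗ (λ x → f x + g x) xs ≡ ∑ₗ f xs + ∑ₗ g xs
    ∑ₗ-+ f g []       = refl
    ∑ₗ-+ f g (x ∷ xs) = trans (cong (f x + g x +_) (∑ₗ-+ f g xs)) (interchange (f x) (g x) _ _)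

    ∑ₗ-* : ∀ c (f : A → ℕ) xs → ∑ₗ (λ x → c * f x) xs ≡ c * ∑ₗ f xs
    ∑ₗ-* c f []       = sym (*-zeroʳ c)
    ∑ₗ-* c f (x ∷ xs) = trans (cong (c * f x +_) (∑ₗ-* c f xs)) (sym (*-distribˡ-+ c (f x) _))

    ∑ₗ-const : ∀ c (xs : List A) → ∑ₗ (λ _ → c) xs ≡ c * length xs
    ∑ₗ-const c []       = sym (*-zeroʳ c)
    ∑ₗ-const c (x ∷ xs) = trans (cong (c +_) (∑ₗ-const c xs)) (sym (*-suc c (length xs)))

    ∑ₗ-cong : ∀ {f g : A → ℕ} {xs} → All (λ x → f x ≡ g x) xs → ∑ₗ f xs ≡ ∑ₗ g xs
    ∑ₗ-cong []           = refl
    ∑ₗ-cong (fx≡gx ∷ eq) = cong₂ _+_ fx≡gx (∑ₗ-cong eq)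

    ∑ₗ-mono-≤ : ∀ {f g : A → ℕ} {xs} → All (λ x → f x ≤ g x) xs → ∑ₗ f xs ≤ ∑ₗ g xs
    ∑ₗ-mono-≤ []           = z≤n
    ∑ₗ-mono-≤ (fx≤gx ∷ le) = +-mono-≤ fx≤gx (∑ₗ-mono-≤ le)

    length≤∑ₗ : ∀ {f : A → ℕ} {xs} → All (λ x → 1 ≤ f x) xs → length xs ≤ ∑ₗ f xs
    length≤∑ₗ []          = z≤n
    length≤∑ₗ (1≤fx ∷ le) = +-mono-≤ 1≤fx (length≤∑ₗ le)

    ∑ₗ-∸ : ∀ r (f : A → ℕ) {xs} → All (λ x → r ≤ f x) xs → ∑ₗ f xs ≡ ∑ₗ (λ x → f x ∸ r) xs + r * length xs
    ∑ₗ-∸ r f {xs} r≤f = begin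
      ∑ₗ f xs                                        ≡⟨ ∑ₗ-cong (All.map (λ r≤fx → sym (m∸n+n≡m r≤fx)) r≤f) ⟩
      ∑ₗ (λ x → f x ∸ r + r) xs                      ≡⟨ ∑ₗ-+ (λ x → f x ∸ r) (λ _ → r) xs ⟩
      ∑ₗ (λ x → f x ∸ r) xs + ∑ₗ (λ _ → r) xs        ≡⟨ cong (∑ₗ (λ x → f x ∸ r) xs +_) (∑ₗ-const r xs) ⟩
      ∑ₗ (λ x → f x ∸ r) xs + r * length xs          ∎
      where open ≡-Reasoning

    module _ {p} {P : Pred A p} (P? : Decidable P) where

      ∑ₗ-filter : ∀ (f : A → ℕ) xs → ∑ₗ f xs ≡ ∑ₗ f (filter P? xs) + ∑ₗ f (filter (∁? P?) xs)
      ∑ₗ-filter f []       = refl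
      ∑ₗ-filter f (x ∷ xs) with ih ← ∑ₗ-filter f xs | P? x
      ... | yes _ = trans (cong (f x +_) ih) (sym (+-assoc (f x) _ _))
      ... | no _  = trans (cong (f x +_) ih) (x∙yz≈y∙xz (f x) (∑ₗ f (filter P? xs)) _)

      length-filter-∁ : ∀ xs → length (filter P? xs) + length (filter (∁? P?) xs) ≡ length xs
      length-filter-∁ []       = refl
      length-filter-∁ (x ∷ xs) with ih ← length-filter-∁ xs | P? x
      ... | yes _ = cong suc ih
      ... | no _  = trans (+-suc _ _) (cong suc ih)

      length-filter≡∑ₗ-indicator : ∀ xs → length (filter P? xs) ≡ ∑ₗ (indicator ∘ P?) xs
      length-filter≡∑ₗ-indicator []       = refl
      length-filter≡∑ₗ-indicator (x ∷ xs) with ih ← length-filter≡∑ₗ-indicator xs | P? x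
      ... | yes _ = cong suc ih
      ... | no _  = ih

  ∑ₐ-∑ₗ : ∀ {a} {A : Set a} n (h : A → Assignment n → ℕ) xs →
    ∑ₐ n (λ β → ∑ₗ (λ x → h x β) xs) ≡ ∑ₗ (λ x → ∑ₐ n (h x)) xs
  ∑ₐ-∑ₗ n h []       = trans (∑ₐ-const n 0) (*-zeroʳ (2 ^ n))
  ∑ₐ-∑ₗ n h (x ∷ xs) = trans (∑ₐ-+ n (h x) (λ β → ∑ₗ (λ x → h x β) xs)) (cong (∑ₐ n (h x) +_) (∑ₐ-∑ₗ n h xs))

  module _ {a p} {A : Set a} {n} {P : Assignment n → Pred A p} (P? : ∀ β → Decidable (P β)) where

    averaging : ∀ (bad : A → Assignment n → ℕ) xs α →
      (∀ β x → 1 ≤ indicator (P? β x) + bad x β) →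
      (∀ β → length (filter (P? β) xs) ≤ length (filter (P? α) xs)) →
      2 ^ n * length (filter (∁? (P? α)) xs) ≤ ∑ₗ (λ x → ∑ₐ n (bad x)) xs
    averaging bad xs α cover best = +-cancelˡ-≤ (2 ^ n * X) _ _ (begin
      2 ^ n * X + 2 ^ n * U                           ≡⟨ *-distribˡ-+ (2 ^ n) X U ⟨
      2 ^ n * (X + U)                                 ≡⟨ cong (2 ^ n *_) (length-filter-∁ (P? α) xs) ⟩
      2 ^ n * length xs                               ≡⟨ ∑ₐ-const n (length xs) ⟨
      ∑ₐ n (λ _ → length xs)                          ≤⟨ ∑ₐ-mono-≤ n (λ β → length≤∑ₗ (All.universal (cover β) xs)) ⟩
      ∑ₐ n (λ β → ∑ₗ (λ x → good β x + bad x β) xs)   ≡⟨ ∑ₐ-cong n (λ β → ∑ₗ-+ (good β) (λ x → bad x β) xs) ⟩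
      ∑ₐ n (λ β → ∑ₗ (good β) xs + ∑ₗ (λ x → bad x β) xs)
                                                      ≡⟨ ∑ₐ-+ n (λ β → ∑ₗ (good β) xs) (λ β → ∑ₗ (λ x → bad x β) xs) ⟩
      ∑ₐ n (λ β → ∑ₗ (good β) xs) + ∑ₐ n (λ β → ∑ₗ (λ x → bad x β) xs)
                                                      ≤⟨ +-mono-≤ (∑ₐ-mono-≤ n good≤X) (≤-reflexive (∑ₐ-∑ₗ n bad xs)) ⟩
      ∑ₐ n (λ _ → X) + ∑ₗ (λ x → ∑ₐ n (bad x)) xs     ≡⟨ cong (_+ _) (∑ₐ-const n X) ⟩
      2 ^ n * X + ∑ₗ (λ x → ∑ₐ n (bad x)) xs          ∎)
      where
      open ≤-Reasoning
      X U : ℕ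
      X = length (filter (P? α) xs)
      U = length (filter (∁? (P? α)) xs)
      good : Assignment n → A → ℕ
      good β = indicator ∘ P? β
      good≤X : ∀ β → ∑ₗ (good β) xs ≤ X
      good≤X β = subst (_≤ X) (length-filter≡∑ₗ-indicator (P? β) xs) (best β)

    maximizer-bound : ∀ k (bad : A → Assignment n → ℕ) (w : A → ℕ) xs α →
      (∀ β x → 1 ≤ indicator (P? β x) + bad x β) →
      All (λ x → 2 ^ k * ∑ₐ n (bad x) ≤ 2 ^ n * w x) xs →
      (∀ β → length (filter (P? β) xs) ≤ length (filter (P? α) xs)) →
      2 ^ k * length (filter (∁? (P? α)) xs) ≤ ∑ₗ w xs
    maximizer-bound k bad w xs α cover weight best = *-cancelˡ-≤ (2 ^ n) {{m^n≢0 2 n}} (begin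
      2 ^ n * (2 ^ k * U)                   ≡⟨ x*[y*z]≡y*[x*z] (2 ^ n) (2 ^ k) U ⟩
      2 ^ k * (2 ^ n * U)                   ≤⟨ *-monoʳ-≤ (2 ^ k) (averaging bad xs α cover best) ⟩
      2 ^ k * ∑ₗ (λ x → ∑ₐ n (bad x)) xs    ≡⟨ ∑ₗ-* (2 ^ k) (λ x → ∑ₐ n (bad x)) xs ⟨
      ∑ₗ (λ x → 2 ^ k * ∑ₐ n (bad x)) xs    ≤⟨ ∑ₗ-mono-≤ weight ⟩
      ∑ₗ (λ x → 2 ^ n * w x) xs             ≡⟨ ∑ₗ-* (2 ^ n) w xs ⟩
      2 ^ n * ∑ₗ w xs                       ∎)
      where
      open ≤-Reasoning
      U : ℕ
      U = length (filter (∁? (P? α)) xs)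

  1≤len : ∀ {n} (C : Clause n) → 1 ≤ len C
  1≤len (clause []      []≢[] _) = ⊥-elim ([]≢[] refl)
  1≤len (clause (_ ∷ _) _      _) = s≤s z≤n

  2≤len : ∀ {n} (C : Clause n) → len C ≢ 1 → 2 ≤ len C
  2≤len C len≢1 with len C | 1≤len C
  ... | suc zero    | _ = ⊥-elim (len≢1 refl)
  ... | suc (suc _) | _ = s≤s (s≤s z≤n)

  rescale : ∀ r K {l s N} → r ≤ l → l ≤ r + K → 2 ^ l * s ≤ N → 2 ^ (r + K) * s ≤ N * 2 ^ (K ∸ (l ∸ r))
  rescale r K {l} {s} {N} r≤l l≤r+K 2^l*s≤N = begin
    2 ^ (r + K) * s      ≡⟨ cong (λ e → 2 ^ e * s) d+l≡r+K ⟨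
    2 ^ (d + l) * s      ≡⟨ cong (_* s) (^-distribˡ-+-* 2 d l) ⟩
    2 ^ d * 2 ^ l * s    ≡⟨ *-assoc (2 ^ d) (2 ^ l) s ⟩
    2 ^ d * (2 ^ l * s)  ≤⟨ *-monoʳ-≤ (2 ^ d) 2^l*s≤N ⟩
    2 ^ d * N            ≡⟨ *-comm (2 ^ d) N ⟩
    N * 2 ^ d            ∎
    where
    open ≤-Reasoning
    d : ℕ
    d = K ∸ (l ∸ r)
    d+l≡r+K : d + l ≡ r + K
    d+l≡r+K = begin-equality
      d + l                ≡⟨ cong (d +_) (m∸n+n≡m r≤l) ⟨
      d + (l ∸ r + r)      ≡⟨ +-assoc d (l ∸ r) r ⟨
      d + (l ∸ r) + r      ≡⟨ cong (_+ r) (m∸n+n≡m (m≤n+o⇒m∸n≤o l r l≤r+K)) ⟩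
      K + r                ≡⟨ +-comm K r ⟩
      r + K                ∎

  maxSat-unsatisfied-bound : ∀ K {n} (F : Formula n) → IsKInstance (1 + K) F → ∀ α → MaxSat F α →
    2 ^ (1 + K) * length (filter (∁? (satisfied? α)) (clauses F))
      ≤ ∑ₗ (λ C → 2 ^ (K ∸ (len C ∸ 1))) (clauses F)
  maxSat-unsatisfied-bound K {n} F kInstance α maxSat =
    maximizer-bound satisfied? (1 + K) (allFalse ∘ lits) (λ C → 2 ^ (K ∸ (len C ∸ 1))) (clauses F) α
      (λ β C → satisfied-or-allFalse β (lits C))
      (All.map (λ {C} len≤ → rescale 1 K (1≤len C) len≤ (∑ₐ-allFalse n (lits C) (Clause.distinct C))) kInstance)
      maxSat

  maxNae-unsatisfied-bound : ∀ K {n} (F : Formula n) → IsKInstance (2 + K) F → NoUnitClause F → ∀ α → MaxNAE F α →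
    2 ^ (1 + K) * length (filter (∁? (naeSatisfied? α)) (clauses F))
      ≤ ∑ₗ (λ C → 2 ^ (K ∸ (len C ∸ 2))) (clauses F)
  maxNae-unsatisfied-bound K {n} F kInstance noUnit α maxNae = *-cancelˡ-≤ 2 (begin
    2 * (2 ^ (1 + K) * U)  ≡⟨ *-assoc 2 (2 ^ (1 + K)) U ⟨
    2 ^ (2 + K) * U        ≤⟨ maximizer-bound naeSatisfied? (2 + K) bad (λ C → 2 * w C) Cs α
                                naeSatisfied-or-constant weights maxNae ⟩
    ∑ₗ (λ C → 2 * w C) Cs  ≡⟨ ∑ₗ-* 2 w Cs ⟩
    2 * ∑ₗ w Cs            ∎)
    where
    open ≤-Reasoning
    Cs : List (Clause n)
    Cs = clauses F
    U : ℕ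
    U = length (filter (∁? (naeSatisfied? α)) Cs)
    w : Clause n → ℕ
    w C = 2 ^ (K ∸ (len C ∸ 2))
    bad : Clause n → Assignment n → ℕ
    bad C β = allFalse (lits C) β + allTrue (lits C) β
    weight : ∀ C → len C ≤ 2 + K → 2 ≤ len C → 2 ^ (2 + K) * ∑ₐ n (bad C) ≤ 2 ^ n * (2 * w C)
    weight C len≤ 2≤len = begin
      2 ^ (2 + K) * ∑ₐ n (bad C)
        ≡⟨ cong (2 ^ (2 + K) *_) (∑ₐ-+ n (allFalse (lits C)) (allTrue (lits C))) ⟩
      2 ^ (2 + K) * (∑ₐ n (allFalse (lits C)) + ∑ₐ n (allTrue (lits C)))
        ≡⟨ *-distribˡ-+ (2 ^ (2 + K)) _ _ ⟩
      2 ^ (2 + K) * ∑ₐ n (allFalse (lits C)) + 2 ^ (2 + K) * ∑ₐ n (allTrue (lits C))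
        ≤⟨ +-mono-≤ (rescale 2 K 2≤len len≤ (∑ₐ-allFalse n (lits C) (Clause.distinct C)))
                    (rescale 2 K 2≤len len≤ (∑ₐ-allTrue n (lits C) (Clause.distinct C))) ⟩
      2 ^ n * w C + 2 ^ n * w C
        ≡⟨ x*y+x*y≡x*[2*y] (2 ^ n) (w C) ⟩
      2 ^ n * (2 * w C) ∎
      where
      x*y+x*y≡x*[2*y] : ∀ x y → x * y + x * y ≡ x * (2 * y)
      x*y+x*y≡x*[2*y] = solve-∀
    weights : All (λ C → 2 ^ (2 + K) * ∑ₐ n (bad C) ≤ 2 ^ n * (2 * w C)) Cs
    weights = All.zipWith (λ {C} (len≤ , len≢1) → weight C len≤ (2≤len C len≢1)) (kInstance , noUnit)

  -- Convexity of j ↦ 2^-j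

  1+n≤2^n : ∀ n → 1 + n ≤ 2 ^ n
  1+n≤2^n zero    = ≤-refl
  1+n≤2^n (suc n) = +-mono-≤ (≤-trans (s≤s z≤n) (1+n≤2^n n)) (≤-trans (1+n≤2^n n) (≤-reflexive (sym (+-identityʳ _))))

  2^n≤1+n*2^n : ∀ n → 2 ^ n ≤ 1 + n * 2 ^ n
  2^n≤1+n*2^n zero    = ≤-refl
  2^n≤1+n*2^n (suc n) = ≤-trans (m≤m+n (2 ^ suc n) (n * 2 ^ suc n)) (n≤1+n _)

  chord-core : ∀ j t a b → a ≤ 1 + t * a → 1 + j ≤ b → (j + t) * a + b * a * j ≤ (j + t) * (b * a) + j
  chord-core j t a b a≤1+ta 1+j≤b = begin
    (j + t) * a + b * a * j              ≡⟨ expand j t a b ⟩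
    j * a + t * a + b * a * j            ≤⟨ +-monoˡ-≤ (b * a * j) (+-monoˡ-≤ (t * a) (*-monoʳ-≤ j a≤1+ta)) ⟩
    j * (1 + t * a) + t * a + b * a * j  ≡⟨ regroup j t a b ⟩
    j + t * a * (1 + j) + b * a * j      ≤⟨ +-monoˡ-≤ (b * a * j) (+-monoʳ-≤ j (*-monoʳ-≤ (t * a) 1+j≤b)) ⟩
    j + t * a * b + b * a * j            ≡⟨ collect j t a b ⟩
    (j + t) * (b * a) + j                ∎
    where
    open ≤-Reasoning
    expand : ∀ j t a b → (j + t) * a + b * a * j ≡ j * a + t * a + b * a * j
    expand = solve-∀
    regroup : ∀ j t a b → j * (1 + t * a) + t * a + b * a * j ≡ j + t * a * (1 + j) + b * a * j
    regroup = solve-∀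
    collect : ∀ j t a b → j + t * a * b + b * a * j ≡ (j + t) * (b * a) + j
    collect = solve-∀

  -- 2^-j <= 1 - j (2^K - 1)/(K 2^K) for j <= K, multiplied by K 2^K.
  chord : ∀ K j → j ≤ K → K * 2 ^ (K ∸ j) + 2 ^ K * j ≤ K * 2 ^ K + j
  chord K j j≤K with t , refl ← m≤n⇒∃[o]m+o≡n j≤K rewrite m+n∸m≡n j t | ^-distribˡ-+-* 2 j t =
    chord-core j t (2 ^ t) (2 ^ j) (2^n≤1+n*2^n t) (1+n≤2^n j)

  ∑ₗ-chord : ∀ {a} {A : Set a} K (j : A → ℕ) {xs} X U → All (λ x → j x ≤ K) xs → length xs ≡ X + U →
    2 ^ (1 + K) * U ≤ ∑ₗ (λ x → 2 ^ (K ∸ j x)) xs →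
    K * 2 ^ K * U + 2 ^ K * ∑ₗ j xs ≤ K * 2 ^ K * X + ∑ₗ j xs
  ∑ₗ-chord K j {xs} X U j≤K M≡X+U U≤W = +-cancelˡ-≤ (K * P * U) _ _ (begin
    K * P * U + (K * P * U + P * J)  ≡⟨ double K P U J ⟩
    K * (2 * P * U) + P * J          ≤⟨ +-monoˡ-≤ (P * J) (*-monoʳ-≤ K U≤W) ⟩
    K * W + P * J                    ≤⟨ chords ⟩
    K * P * length xs + J            ≡⟨ cong (λ m → K * P * m + J) M≡X+U ⟩
    K * P * (X + U) + J              ≡⟨ split K P U X J ⟩
    K * P * U + (K * P * X + J)      ∎)
    where
    open ≤-Reasoning
    P J W : ℕ
    P = 2 ^ K
    J = ∑ₗ j xs
    W = ∑ₗ (λ x → 2 ^ (K ∸ j x)) xs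
    double : ∀ K P U J → K * P * U + (K * P * U + P * J) ≡ K * (2 * P * U) + P * J
    double = solve-∀
    split : ∀ K P U X J → K * P * (X + U) + J ≡ K * P * U + (K * P * X + J)
    split = solve-∀
    chords : K * W + P * J ≤ K * P * length xs + J
    chords = begin
      K * W + P * J                                           ≡⟨ cong₂ _+_ (∑ₗ-* K _ xs) (∑ₗ-* P j xs) ⟨
      ∑ₗ (λ x → K * 2 ^ (K ∸ j x)) xs + ∑ₗ (λ x → P * j x) xs ≡⟨ ∑ₗ-+ _ _ xs ⟨
      ∑ₗ (λ x → K * 2 ^ (K ∸ j x) + P * j x) xs               ≤⟨ ∑ₗ-mono-≤ (All.map (chord K _) j≤K) ⟩
      ∑ₗ (λ x → K * P + j x) xs                               ≡⟨ ∑ₗ-+ _ j xs ⟩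
      ∑ₗ (λ _ → K * P) xs + J                                 ≡⟨ cong (_+ J) (∑ₗ-const (K * P) xs) ⟩
      K * P * length xs + J                                   ∎

  naeSatisfiable-2-clause : ∀ {n} (C : Clause n) → len C ≡ 2 → ∃ λ β → does (naeSatisfied? β C) ≡ true
  naeSatisfiable-2-clause C@(clause ((x , b) ∷ (y , c) ∷ _) _ ((xb≢yc ∷ _) ∷ _)) _ =
    β , dec-true (naeSatisfied? β C) (here βx≡b , there (here βy≢c))
    where
    β : Assignment _
    β z = if does (z ≟ᶠ x) then b else not c
    βx≡b : β x ≡ b
    βx≡b with x ≟ᶠ x
    ... | yes _   = refl
    ... | no x≢x  = ⊥-elim (x≢x refl)
    βy≢c : β y ≢ c
    βy≢c with y ≟ᶠ x
    ... | yes refl = λ b≡c → xb≢yc (cong (y ,_) b≡c)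
    ... | no _     = not-¬ refl ∘ sym

  0<length-naeClauses : ∀ {n} (Cs : List (Clause n)) α → Cs ≢ [] → All (λ C → len C ≡ 2) Cs →
    (∀ β → length (naeClauses β Cs) ≤ length (naeClauses α Cs)) → 0 < length (naeClauses α Cs)
  0<length-naeClauses []       α []≢[] _            _      = ⊥-elim ([]≢[] refl)
  0<length-naeClauses (C ∷ Cs) α _     (len≡2 ∷ _) maxNae with β , C-nae ← naeSatisfiable-2-clause C len≡2 =
    ≤-trans 0<β (maxNae β)
    where
    0<β : 0 < length (naeClauses β (C ∷ Cs))
    0<β rewrite C-nae = s≤s z≤n

-- Passing to rationals

module _ where
  open import Data.Nat.Base as ℕ using (ℕ; zero; suc; _∸_; _^_; z≤n; s≤s)
  import Data.Nat.Properties as ℕ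
  open import Data.Integer.Base as ℤ using (+_)
  import Data.Integer.Properties as ℤ
  open import Data.Nat.Coprimality as Coprime using (1-coprimeTo)
  open import Data.Rational
    using (ℚ; mkℚ; _/_; _+_; _-_; -_; _*_; _≤_; _<_; 0ℚ; 1ℚ; *≤*; *<*; NonNegative; positive; nonNegative; ≢-nonZero)
  open import Data.Rational.Properties
  open import Data.Rational.Unnormalised as ℚᵘ using (mkℚᵘ; *≡*)
  import Data.Rational.Unnormalised.Properties as ℚᵘ
  open import Tactic.RingSolver using (solve-∀)
  import Tactic.RingSolver.Core.AlmostCommutativeRing as ACR
  open import Data.List using (List; []; length; filter)
  open import Data.List.Relation.Unary.All as All using (All)
  open import Data.List.Relation.Unary.All.Properties using (filter⁺)
  open import Relation.Nullary using (yes; no; dec⇒maybe)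
  open import Relation.Unary using (Pred; Decidable)
  open import Relation.Unary.Properties using (∁?)
  open import Relation.Binary.PropositionalEquality hiding (J)
  open import Data.Empty using (⊥-elim)
  open import Data.Product using (_,_)

  ℚ-ring : ACR.AlmostCommutativeRing _ _
  ℚ-ring = ACR.fromCommutativeRing +-*-commutativeRing (λ p → dec⇒maybe (0ℚ ≟ p))

  ℕ→ℚ≡mkℚ : ∀ m → ℕ→ℚ m ≡ mkℚ (+ m) 0 (Coprime.sym (1-coprimeTo m))
  ℕ→ℚ≡mkℚ m = normalize-coprime (Coprime.sym (1-coprimeTo m))

  ℕ→ℚ-+ : ∀ m n → ℕ→ℚ (m ℕ.+ n) ≡ ℕ→ℚ m + ℕ→ℚ n
  ℕ→ℚ-+ m n rewrite ℕ→ℚ≡mkℚ m | ℕ→ℚ≡mkℚ n = /-cong {p₁ = + (m ℕ.+ n)}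
    (trans (ℤ.pos-+ m n) (sym (cong₂ ℤ._+_ (ℤ.*-identityʳ (+ m)) (ℤ.*-identityʳ (+ n))))) refl

  ℕ→ℚ-* : ∀ m n → ℕ→ℚ (m ℕ.* n) ≡ ℕ→ℚ m * ℕ→ℚ n
  ℕ→ℚ-* m n rewrite ℕ→ℚ≡mkℚ m | ℕ→ℚ≡mkℚ n = /-cong {p₁ = + (m ℕ.* n)} (ℤ.pos-* m n) refl

  ℕ→ℚ-mono-≤ : ∀ {m n} → m ℕ.≤ n → ℕ→ℚ m ≤ ℕ→ℚ n
  ℕ→ℚ-mono-≤ {m} {n} m≤n rewrite ℕ→ℚ≡mkℚ m | ℕ→ℚ≡mkℚ n =
    *≤* (subst₂ ℤ._≤_ (sym (ℤ.*-identityʳ (+ m))) (sym (ℤ.*-identityʳ (+ n))) (ℤ.+≤+ m≤n))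

  ℕ→ℚ-mono-< : ∀ {m n} → m ℕ.< n → ℕ→ℚ m < ℕ→ℚ n
  ℕ→ℚ-mono-< {m} {n} m<n rewrite ℕ→ℚ≡mkℚ m | ℕ→ℚ≡mkℚ n =
    *<* (subst₂ ℤ._<_ (sym (ℤ.*-identityʳ (+ m))) (sym (ℤ.*-identityʳ (+ n))) (ℤ.+<+ m<n))

  inv*p≡1 : ∀ p → 0ℚ < p → inv p * p ≡ 1ℚ
  inv*p≡1 p 0<p with p ≟ 0ℚ
  ... | yes refl = ⊥-elim (<-irrefl refl 0<p)
  ... | no p≢0   = *-inverseˡ p {{≢-nonZero p≢0}}

  0≤inv : ∀ p → 0ℚ < p → 0ℚ ≤ inv p
  0≤inv p 0<p with p ≟ 0ℚ
  ... | yes refl = ⊥-elim (<-irrefl refl 0<p)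
  ... | no p≢0   = <⇒≤ (positive⁻¹ _ {{1/pos⇒pos p {{positive 0<p}}}})

  p<q⇒0<q-p : ∀ {p q} → p < q → 0ℚ < q - p
  p<q⇒0<q-p {p} {q} p<q = subst (_< q - p) (+-inverseʳ p) (+-monoˡ-< (- p) p<q)

  *-cancelʳ-≡ : ∀ {p q} r → 0ℚ < r → p * r ≡ q * r → p ≡ q
  *-cancelʳ-≡ r 0<r pr≡qr = ≤-antisym (*-cancelʳ-≤-pos r {{positive 0<r}} (≤-reflexive pr≡qr))
                                       (*-cancelʳ-≤-pos r {{positive 0<r}} (≤-reflexive (sym pr≡qr)))

  [m/d]*d≡m : ∀ m d → (+ m / suc d) * ℕ→ℚ (suc d) ≡ ℕ→ℚ m
  [m/d]*d≡m m d = toℚᵘ-injective (ℚᵘ.≃-trans (toℚᵘ-homo-* (+ m / suc d) (ℕ→ℚ (suc d)))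
    (ℚᵘ.≃-trans (ℚᵘ.*-cong (toℚᵘ-fromℚᵘ (mkℚᵘ (+ m) d)) (toℚᵘ-fromℚᵘ (mkℚᵘ (+ suc d) 0)))
    (ℚᵘ.≃-trans unnormalised (ℚᵘ.≃-sym (toℚᵘ-fromℚᵘ (mkℚᵘ (+ m) 0))))))
    where
    unnormalised : mkℚᵘ (+ m) d ℚᵘ.* mkℚᵘ (+ suc d) 0 ℚᵘ.≃ mkℚᵘ (+ m) 0
    unnormalised = *≡* (trans (ℤ.*-identityʳ (+ m ℤ.* + suc d)) (cong (λ e → + m ℤ.* + e) (sym (ℕ.*-identityʳ (suc d)))))

  avgLen*length : ∀ {n} (Cs : List (Clause n)) → 0 ℕ.< length Cs → avgLen Cs * ℕ→ℚ (length Cs) ≡ ℕ→ℚ (∑ₗ len Cs)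
  avgLen*length Cs 0<len with length Cs
  avgLen*length Cs ()    | zero
  ... | suc m = [m/d]*d≡m (∑ₗ len Cs) m

  0<avgLen⇒0<length : ∀ {n} (Cs : List (Clause n)) → 0ℚ < avgLen Cs → 0 ℕ.< length Cs
  0<avgLen⇒0<length Cs 0<avg with length Cs
  ... | zero  = ⊥-elim (<-irrefl refl 0<avg)
  ... | suc _ = s≤s z≤n

  avgLen-excess : ∀ {n} r (Cs : List (Clause n)) → All (λ C → r ℕ.≤ len C) Cs → 0 ℕ.< length Cs →
    (avgLen Cs - ℕ→ℚ r) * ℕ→ℚ (length Cs) ≡ ℕ→ℚ (∑ₗ (λ C → len C ∸ r) Cs)
  avgLen-excess r Cs r≤len 0<M = begin
    (avgLen Cs - ℕ→ℚ r) * ℕ→ℚ M                ≡⟨ distrib (avgLen Cs) (ℕ→ℚ r) (ℕ→ℚ M) ⟩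
    avgLen Cs * ℕ→ℚ M - ℕ→ℚ r * ℕ→ℚ M          ≡⟨ cong (_- ℕ→ℚ r * ℕ→ℚ M) (avgLen*length Cs 0<M) ⟩
    ℕ→ℚ (∑ₗ len Cs) - ℕ→ℚ r * ℕ→ℚ M            ≡⟨ cong (λ L → ℕ→ℚ L - ℕ→ℚ r * ℕ→ℚ M) (∑ₗ-∸ r len r≤len) ⟩
    ℕ→ℚ (J ℕ.+ r ℕ.* M) - ℕ→ℚ r * ℕ→ℚ M        ≡⟨ cong (_- ℕ→ℚ r * ℕ→ℚ M) (trans (ℕ→ℚ-+ J (r ℕ.* M)) (cong (_+_ (ℕ→ℚ J)) (ℕ→ℚ-* r M))) ⟩
    ℕ→ℚ J + ℕ→ℚ r * ℕ→ℚ M - ℕ→ℚ r * ℕ→ℚ M      ≡⟨ cancel (ℕ→ℚ J) (ℕ→ℚ r * ℕ→ℚ M) ⟩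
    ℕ→ℚ J                                      ∎
    where
    open ≡-Reasoning
    M J : ℕ
    M = length Cs
    J = ∑ₗ (λ C → len C ∸ r) Cs
    distrib : ∀ a b c → (a - b) * c ≡ a * c - b * c
    distrib = solve-∀ ℚ-ring
    cancel : ∀ a b → a + b - b ≡ a
    cancel = solve-∀ ℚ-ring

  avgLen-const : ∀ {n} r (Cs : List (Clause n)) → All (λ C → len C ≡ r) Cs → 0 ℕ.< length Cs → avgLen Cs ≡ ℕ→ℚ r
  avgLen-const r Cs len≡r 0<M = *-cancelʳ-≡ (ℕ→ℚ (length Cs)) (ℕ→ℚ-mono-< 0<M) (begin
    avgLen Cs * ℕ→ℚ (length Cs)  ≡⟨ avgLen*length Cs 0<M ⟩
    ℕ→ℚ (∑ₗ len Cs)              ≡⟨ cong ℕ→ℚ (trans (∑ₗ-cong len≡r) (∑ₗ-const r Cs)) ⟩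
    ℕ→ℚ (r ℕ.* length Cs)        ≡⟨ ℕ→ℚ-* r (length Cs) ⟩
    ℕ→ℚ r * ℕ→ℚ (length Cs)      ∎)
    where open ≡-Reasoning

  chordSlope : ℕ → ℚ
  chordSlope K = inv (ℕ→ℚ K) * ((ℕ→ℚ (2 ^ K) - 1ℚ) * inv (ℕ→ℚ (2 ^ K)))

  chordSlope-bound : ∀ K {U X J} → 1 ℕ.≤ K →
    K ℕ.* 2 ^ K ℕ.* U ℕ.+ 2 ^ K ℕ.* J ℕ.≤ K ℕ.* 2 ^ K ℕ.* X ℕ.+ J →
    ℕ→ℚ U + chordSlope K * ℕ→ℚ J ≤ ℕ→ℚ X
  chordSlope-bound K {U} {X} {J} 1≤K ineq = *-cancelʳ-≤-pos (k * p) {{positive 0<kp}} (begin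
    (u + chordSlope K * j) * (k * p)
      ≡⟨ expand u (inv k) k p (inv p) j ⟩
    k * p * u + p * j + inv k * k * (inv p * p) * (p - 1ℚ) * j - p * j
      ≡⟨ cong₂ (λ a b → k * p * u + p * j + a * b * (p - 1ℚ) * j - p * j) (inv*p≡1 k 0<k) (inv*p≡1 p 0<p) ⟩
    k * p * u + p * j + 1ℚ * 1ℚ * (p - 1ℚ) * j - p * j
      ≤⟨ +-monoˡ-≤ (- (p * j)) (+-monoˡ-≤ (1ℚ * 1ℚ * (p - 1ℚ) * j) ineqℚ) ⟩
    k * p * x + j + 1ℚ * 1ℚ * (p - 1ℚ) * j - p * j
      ≡⟨ collapse k p x j ⟩
    x * (k * p) ∎)
    where
    open ≤-Reasoning
    k p u x j : ℚ
    k = ℕ→ℚ K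
    p = ℕ→ℚ (2 ^ K)
    u = ℕ→ℚ U
    x = ℕ→ℚ X
    j = ℕ→ℚ J
    0<k : 0ℚ < k
    0<k = ℕ→ℚ-mono-< 1≤K
    0<p : 0ℚ < p
    0<p = ℕ→ℚ-mono-< (ℕ.m^n>0 2 K)
    0<kp : 0ℚ < k * p
    0<kp = positive⁻¹ _ {{pos*pos⇒pos k {{positive 0<k}} p {{positive 0<p}}}}
    ℕ→ℚ-K*P*V : ∀ V → ℕ→ℚ (K ℕ.* 2 ^ K ℕ.* V) ≡ k * p * ℕ→ℚ V
    ℕ→ℚ-K*P*V V = trans (ℕ→ℚ-* (K ℕ.* 2 ^ K) V) (cong (_* ℕ→ℚ V) (ℕ→ℚ-* K (2 ^ K)))
    ineqℚ : k * p * u + p * j ≤ k * p * x + j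
    ineqℚ = subst₂ _≤_ (trans (ℕ→ℚ-+ (K ℕ.* 2 ^ K ℕ.* U) (2 ^ K ℕ.* J)) (cong₂ _+_ (ℕ→ℚ-K*P*V U) (ℕ→ℚ-* (2 ^ K) J)))
                       (trans (ℕ→ℚ-+ (K ℕ.* 2 ^ K ℕ.* X) J) (cong (_+ j) (ℕ→ℚ-K*P*V X)))
                       (ℕ→ℚ-mono-≤ ineq)
    expand : ∀ u i k p i′ j →
      (u + i * ((p - 1ℚ) * i′) * j) * (k * p) ≡ k * p * u + p * j + i * k * (i′ * p) * (p - 1ℚ) * j - p * j
    expand = solve-∀ ℚ-ring
    collapse : ∀ k p x j → k * p * x + j + 1ℚ * 1ℚ * (p - 1ℚ) * j - p * j ≡ x * (k * p)
    collapse = solve-∀ ℚ-ring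

  reciprocal-inequality : ∀ {e s M X U J Y c} → 0ℚ < e → 0ℚ < s → 0ℚ < M →
    e * M ≡ J → s * X ≡ Y → Y ≤ J → M ≡ X + U → U + c * J ≤ X →
    inv e + c ≤ ℕ→ℚ 2 * inv s
  reciprocal-inequality {e} {s} {M} {X} {U} {J} {Y} {c} 0<e 0<s 0<M eM≡J sX≡Y Y≤J M≡X+U U+cJ≤X =
    *-cancelʳ-≤-pos J {{positive 0<J}} (begin
      (inv e + c) * J                 ≡⟨ cong ((inv e + c) *_) eM≡J ⟨
      (inv e + c) * (e * M)           ≡⟨ distrib (inv e) c e M ⟩
      inv e * e * M + c * (e * M)     ≡⟨ cong₂ (λ i J′ → i * M + c * J′) (inv*p≡1 e 0<e) eM≡J ⟩
      1ℚ * M + c * J                  ≡⟨ cong (_+ c * J) (trans (*-identityˡ M) M≡X+U) ⟩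
      X + U + c * J                   ≡⟨ +-assoc X U (c * J) ⟩
      X + (U + c * J)                 ≤⟨ +-monoʳ-≤ X U+cJ≤X ⟩
      X + X                           ≡⟨ double X ⟩
      ℕ→ℚ 2 * (1ℚ * X)                ≡⟨ cong (λ i → ℕ→ℚ 2 * (i * X)) (inv*p≡1 s 0<s) ⟨
      ℕ→ℚ 2 * (inv s * s * X)         ≡⟨ reassociate (ℕ→ℚ 2) (inv s) s X ⟩
      ℕ→ℚ 2 * inv s * (s * X)         ≡⟨ cong (ℕ→ℚ 2 * inv s *_) sX≡Y ⟩
      ℕ→ℚ 2 * inv s * Y               ≤⟨ *-monoˡ-≤-nonNeg (ℕ→ℚ 2 * inv s) {{0≤2inv}} Y≤J ⟩
      ℕ→ℚ 2 * inv s * J               ∎)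
    where
    open ≤-Reasoning
    0<J : 0ℚ < J
    0<J = subst (0ℚ <_) eM≡J (positive⁻¹ _ {{pos*pos⇒pos e {{positive 0<e}} M {{positive 0<M}}}})
    0≤2inv : NonNegative (ℕ→ℚ 2 * inv s)
    0≤2inv = nonNeg*nonNeg⇒nonNeg (ℕ→ℚ 2) (inv s) {{nonNegative (0≤inv s 0<s)}}
    distrib : ∀ i c e M → (i + c) * (e * M) ≡ i * e * M + c * (e * M)
    distrib = solve-∀ ℚ-ring
    double : ∀ x → x + x ≡ (1ℚ + 1ℚ) * (1ℚ * x)
    double = solve-∀ ℚ-ring
    reassociate : ∀ w i s x → w * (i * s * x) ≡ w * i * (s * x)
    reassociate = solve-∀ ℚ-ring

  avgLen-reciprocal-bound : ∀ {n p} {P : Pred (Clause n) p} (P? : Decidable P) r K (Cs : List (Clause n)) →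
    1 ℕ.≤ r → 1 ℕ.≤ K → All (λ C → r ℕ.≤ len C) Cs → All (λ C → len C ℕ.≤ r ℕ.+ K) Cs →
    2 ^ (1 ℕ.+ K) ℕ.* length (filter (∁? P?) Cs) ℕ.≤ ∑ₗ (λ C → 2 ^ (K ∸ (len C ∸ r))) Cs →
    ℕ→ℚ r < avgLen Cs → ℕ→ℚ r < avgLen (filter P? Cs) →
    inv (avgLen Cs - ℕ→ℚ r) + chordSlope K ≤ ℕ→ℚ 2 * inv (avgLen (filter P? Cs) - ℕ→ℚ r)
  avgLen-reciprocal-bound P? r K Cs 1≤r 1≤K r≤len len≤r+K unsat r<η r<θ =
    reciprocal-inequality (p<q⇒0<q-p r<η) (p<q⇒0<q-p r<θ) (ℕ→ℚ-mono-< 0<M)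
      (avgLen-excess r Cs r≤len 0<M) (avgLen-excess r Good (filter⁺ P? r≤len) 0<X)
      (ℕ→ℚ-mono-≤ excessGood≤excess) (trans (cong ℕ→ℚ (sym X+U≡M)) (ℕ→ℚ-+ X U))
      (chordSlope-bound K 1≤K (∑ₗ-chord K excess X U excess≤K (sym X+U≡M) unsat))
    where
    Good : List (Clause _)
    Good = filter P? Cs
    X U : ℕ
    X = length Good
    U = length (filter (∁? P?) Cs)
    X+U≡M : X ℕ.+ U ≡ length Cs
    X+U≡M = length-filter-∁ P? Cs
    excess : Clause _ → ℕ
    excess C = len C ∸ r
    excess≤K : All (λ C → excess C ℕ.≤ K) Cs
    excess≤K = All.map (λ {C} → ℕ.m≤n+o⇒m∸n≤o (len C) r) len≤r+K
    excessGood≤excess : ∑ₗ excess Good ℕ.≤ ∑ₗ excess Cs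
    excessGood≤excess = subst (∑ₗ excess Good ℕ.≤_) (sym (∑ₗ-filter P? excess Cs)) (ℕ.m≤m+n _ _)
    0<r : 0ℚ < ℕ→ℚ r
    0<r = ℕ→ℚ-mono-< 1≤r
    0<M : 0 ℕ.< length Cs
    0<M = 0<avgLen⇒0<length Cs (<-trans 0<r r<η)
    0<X : 0 ℕ.< X
    0<X = 0<avgLen⇒0<length Good (<-trans 0<r r<θ)

  avgLen-naeClauses-2 : ∀ {n} (F : Formula n) → IsKInstance 2 F → NoUnitClause F → ∀ α → MaxNAE F α →
    clauses F ≢ [] → avgLen (naeClauses α (clauses F)) ≡ ℕ→ℚ 2
  avgLen-naeClauses-2 F kInstance noUnit α maxNae Cs≢[] =
    avgLen-const 2 (naeClauses α (clauses F)) (filter⁺ (naeSatisfied? α) len≡2)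
      (0<length-naeClauses (clauses F) α Cs≢[] len≡2 maxNae)
    where
    len≡2 : All (λ C → len C ≡ 2) (clauses F)
    len≡2 = All.zipWith (λ {C} (len≤2 , len≢1) → ℕ.≤-antisym len≤2 (2≤len C len≢1)) (kInstance , noUnit)

open import Data.Nat using (ℕ; zero; suc; _∸_; _^_; z≤n; s≤s; s≤s⁻¹)
open import Data.Nat.Properties using (≤-refl)
open import Data.Rational using (ℚ; _+_; _-_; _*_; _≤_; _<_; 1ℚ)
open import Data.List using ([])
open import Data.List.Relation.Unary.All as All using ()
open import Data.Product using (_×_; _,_)
open import Relation.Nullary using (¬_)
open import Relation.Binary.PropositionalEquality using (_≡_; subst)

lemma5p6 : ∀ (k n : ℕ) → 2 Data.Nat.≤ k → (F : Formula n) → IsKInstance k F →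
    ((α : Assignment n) → MaxSat F α →
      1ℚ < avgLen (clauses F) → 1ℚ < avgLen (satClauses α (clauses F)) →
      inv (avgLen (clauses F) - 1ℚ)
        + inv (ℕ→ℚ (k ∸ 1)) * ((ℕ→ℚ (2 ^ (k ∸ 1)) - 1ℚ) * inv (ℕ→ℚ (2 ^ (k ∸ 1))))
        ≤ ℕ→ℚ 2 * inv (avgLen (satClauses α (clauses F)) - 1ℚ))
    × (NoUnitClause F →
        ((α : Assignment n) → MaxNAE F α →
          k ≡ 2 → ¬ (clauses F ≡ []) → avgLen (naeClauses α (clauses F)) ≡ ℕ→ℚ 2)
        × ((α : Assignment n) → MaxNAE F α →
          3 Data.Nat.≤ k → ℕ→ℚ 2 < avgLen (clauses F) → ℕ→ℚ 2 < avgLen (naeClauses α (clauses F)) →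
          inv (avgLen (clauses F) - ℕ→ℚ 2)
            + inv (ℕ→ℚ (k ∸ 2)) * ((ℕ→ℚ (2 ^ (k ∸ 2)) - 1ℚ) * inv (ℕ→ℚ (2 ^ (k ∸ 2))))
            ≤ ℕ→ℚ 2 * inv (avgLen (naeClauses α (clauses F)) - ℕ→ℚ 2)))
lemma5p6 zero          n ()       F kInstance
lemma5p6 (suc zero)    n (s≤s ()) F kInstance
lemma5p6 (suc (suc K)) n _        F kInstance =
  (λ α maxSat →
    avgLen-reciprocal-bound (satisfied? α) 1 (suc K) (clauses F) ≤-refl (s≤s z≤n)
      (All.universal 1≤len (clauses F)) kInstance (maxSat-unsatisfied-bound (suc K) F kInstance α maxSat)) ,
  λ noUnit →
    (λ α maxNae k≡2 →
      avgLen-naeClauses-2 F (subst (λ k → IsKInstance k F) k≡2 kInstance) noUnit α maxNae) ,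
    (λ α maxNae 3≤k →
      avgLen-reciprocal-bound (naeSatisfied? α) 2 K (clauses F) (s≤s z≤n) (s≤s⁻¹ (s≤s⁻¹ 3≤k))
        (All.map (λ {C} → 2≤len C) noUnit) kInstance (maxNae-unsatisfied-bound K F kInstance noUnit α maxNae))
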